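{- Let $\mathbb{F}$ be a finite field with $|\mathbb{F}|\ne 2$ and let $n\ge 2$. Then the unitary Cayley graph $C_{T_n(\mathbb{F})}$ is connected.
   Context: For a finite ring $R$ with identity, the unitary Cayley graph $C_R$ is the simple graph with vertex set $R$ in which distinct $x,y\in R$ are adjacent if and only if $x-y$ is a unit of $R$. $T_n(\mathbb{F})$ denotes the ring of all upper triangular $n\times n$ matrices over $\mathbb{F}$. -}

module Defs where

open import Level using (Level; _⊔_)
open import Data.Nat using (ℕ; suc; _<_)
open import Data.Fin using (Fin; toℕ)
open import Data.Product using (Σ; ∃; _×_; _,_; proj₁; proj₂)
open import Relation.Nullary using (¬_)
open import Relation.Binary.PropositionalEquality using (_≡_)
open import Relation.Binary.Construct.Closure.ReflexiveTransitive using (Star)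
open import Algebra.Bundles using (CommutativeRing)
import Algebra.Definitions.RawMonoid as RawMonoidDefs

record IsField {c ℓ : Level} (F : CommutativeRing c ℓ) : Set (c ⊔ ℓ) where
  open CommutativeRing F
  field
    1≉0     : ¬ (1# ≈ 0#)
    inverse : ∀ x → ¬ (x ≈ 0#) → ∃ λ y → x * y ≈ 1#

record HasCardinality {c ℓ : Level} (F : CommutativeRing c ℓ) (q : ℕ) : Set (c ⊔ ℓ) where
  open CommutativeRing F
  field
    enum       : Fin q → Carrier
    surjective : ∀ x → ∃ λ i → enum i ≈ x
    injective  : ∀ i j → enum i ≈ enum j → i ≡ j

module UpperTriangular {c ℓ : Level} (F : CommutativeRing c ℓ) (n : ℕ) where
  open CommutativeRing F
  open RawMonoidDefs +-rawMonoid using (sum)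

  Matrix : Set c
  Matrix = Fin n → Fin n → Carrier

  IsUpper : Matrix → Set ℓ
  IsUpper A = ∀ i j → toℕ j < toℕ i → A i j ≈ 0#

  Tn : Set (c ⊔ ℓ)
  Tn = Σ Matrix IsUpper

  _≈ᴹ_ : Matrix → Matrix → Set ℓ
  A ≈ᴹ B = ∀ i j → A i j ≈ B i j

  _-ᴹ_ : Matrix → Matrix → Matrix
  (A -ᴹ B) i j = A i j - B i j

  _*ᴹ_ : Matrix → Matrix → Matrix
  (A *ᴹ B) i j = sum (λ k → A i k * B k j)

  Iᴹ : Matrix
  Iᴹ i j with i Data.Fin.≟ j
  ... | Relation.Nullary.yes _ = 1#
  ... | Relation.Nullary.no  _ = 0#

  IsUnit : Tn → Set (c ⊔ ℓ)
  IsUnit A = ∃ λ (B : Tn) → ((proj₁ A *ᴹ proj₁ B) ≈ᴹ Iᴹ) × ((proj₁ B *ᴹ proj₁ A) ≈ᴹ Iᴹ)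

  Adj : Tn → Tn → Set (c ⊔ ℓ)
  Adj A B = ¬ (proj₁ A ≈ᴹ proj₁ B) × IsUnit ((proj₁ A -ᴹ proj₁ B) , upper-diff)
    where
    upper-diff : IsUpper (proj₁ A -ᴹ proj₁ B)
    upper-diff i j j<i =
      trans (+-cong (proj₂ A i j j<i) (-‿cong (proj₂ B i j j<i))) (-‿inverseʳ 0#)

  Connected : Set (c ⊔ ℓ)
  Connected = ∀ (A B : Tn) → Star Adj A B

-- An upper triangular matrix over a commutative ring is a unit of Tₙ as soon as its
-- diagonal entries are units: by induction on n, if a b ≈ 1 and M′ B′ ≈ I ≈ B′ M′, then
-- [[a, r], [0, M′]] has inverse [[b, -b r B′], [0, B′]]. So A and B are adjacent whenever
-- every diagonal entry of A - B is a unit. In a field with at least three elements every d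
-- is a sum of two units v + (d - v), taking v ∉ {0, d}; choosing such vᵢ for dᵢ = Aᵢᵢ - Bᵢᵢ,
-- the matrix B + diag(v) is adjacent to both A and B. Hence the graph has diameter at most 2,
-- already for n ≥ 1.
module Submission where

open import Defs
open import Level using (Level; _⊔_)
open import Data.Empty using (⊥-elim)
open import Data.Nat using (ℕ; _≥_; zero; suc; s≤s; z≤n)
open import Data.Fin using (Fin; zero; suc)
import Data.Fin.Properties as Fin
open import Data.Product using (∃; _×_; _,_; proj₁; proj₂; map₂; swap)
open import Data.Vec.Functional using (Vector; _∷_; tail)
import Data.Vec.Functional.Relation.Binary.Pointwise.Properties as Pointwise
open import Function using (_∘_)
open import Relation.Nullary using (¬_; yes; no)
open import Relation.Nullary.Decidable using (map′)
open import Relation.Binary.Bundles using (Setoid; DecSetoid)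
open import Relation.Binary.Definitions using (Decidable)
open import Relation.Binary.PropositionalEquality as ≡ using (_≡_; _≢_)
open import Relation.Binary.Construct.Closure.ReflexiveTransitive using (ε; _◅_)
import Relation.Binary.Reasoning.Setoid as SetoidReasoning
open import Algebra.Bundles using (CommutativeRing)
import Algebra.Definitions

module UpperTriangularMatrices {c ℓ : Level} (R : CommutativeRing c ℓ) where
  open CommutativeRing R hiding (zero)
  open Algebra.Definitions _≈_ using (RightInvertible)
  open import Algebra.Properties.Ring ring using (-‿distribˡ-*; -‿distribʳ-*; -1*x≈-x)
  open import Algebra.Properties.Semiring.Sum semiring
  open import Data.Vec.Functional.Relation.Binary.Equality.Setoid setoid
  open module UT {n} = UpperTriangular R n public

  IsInvertible : Carrier → Set (c ⊔ ℓ)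
  IsInvertible = RightInvertible 1# _*_

  matrixSetoid : ℕ → Setoid c ℓ
  matrixSetoid n = Pointwise.setoid (≋-setoid n) n

  module _ {n : ℕ} where
    open Setoid (matrixSetoid n) public
      using () renaming (sym to ≈ᴹ-sym; trans to ≈ᴹ-trans)

  infixl 7 _ᵛ*_
  _ᵛ*_ : ∀ {n} → Vector Carrier n → Matrix {n} → Vector Carrier n
  (r ᵛ* A) j = sum λ k → r k * A k j

  sum-*-zeroʳ : ∀ {n} (r : Vector Carrier n) → sum (λ k → r k * 0#) ≈ 0#
  sum-*-zeroʳ {n} r = trans (sum-cong-≋ (zeroʳ ∘ r)) (sum-replicate-zero n)

  ᵛ*-congʳ : ∀ {n} (r : Vector Carrier n) {A B : Matrix} → A ≈ᴹ B → r ᵛ* A ≋ r ᵛ* B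
  ᵛ*-congʳ r A≈B j = sum-cong-≋ λ k → *-congˡ (A≈B k j)

  *ᴹ-congˡ : ∀ {n} (B : Matrix {n}) {A A′ : Matrix} → A ≈ᴹ A′ → (A *ᴹ B) ≈ᴹ (A′ *ᴹ B)
  *ᴹ-congˡ B A≈A′ i j = sum-cong-≋ λ k → *-congʳ (A≈A′ i k)

  *ᴹ-congʳ : ∀ {n} (A : Matrix {n}) {B B′ : Matrix} → B ≈ᴹ B′ → (A *ᴹ B) ≈ᴹ (A *ᴹ B′)
  *ᴹ-congʳ A B≈B′ i = ᵛ*-congʳ (A i) B≈B′

  ᵛ*-*ᴹ-assoc : ∀ {n} (r : Vector Carrier n) (A B : Matrix) → (r ᵛ* A) ᵛ* B ≋ r ᵛ* (A *ᴹ B)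
  ᵛ*-*ᴹ-assoc r A B j = begin
    sum (λ k → sum (λ m → r m * A m k) * B k j)
      ≈⟨ sum-cong-≋ (λ k → *-distribʳ-sum (B k j) (λ m → r m * A m k)) ⟩
    sum (λ k → sum (λ m → r m * A m k * B k j))
      ≈⟨ ∑-comm (λ k m → r m * A m k * B k j) ⟩
    sum (λ m → sum (λ k → r m * A m k * B k j))
      ≈⟨ sum-cong-≋ (λ m → trans (sum-cong-≋ λ k → *-assoc (r m) (A m k) (B k j))
                                 (sym (*-distribˡ-sum (r m) (λ k → A m k * B k j)))) ⟩
    sum (λ m → r m * sum (λ k → A m k * B k j)) ∎
    where open SetoidReasoning setoid

  ᵛ*-scalarˡ : ∀ {n} x (r : Vector Carrier n) (A : Matrix) →
               (λ k → x * r k) ᵛ* A ≋ λ j → x * (r ᵛ* A) j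
  ᵛ*-scalarˡ x r A j =
    trans (sum-cong-≋ λ k → *-assoc x (r k) (A k j)) (sym (*-distribˡ-sum x (λ k → r k * A k j)))

  Iᴹ-suc : ∀ {n} (k l : Fin n) → Iᴹ (suc k) (suc l) ≡ Iᴹ k l
  Iᴹ-suc k l with k Fin.≟ l
  ... | yes _ = ≡.refl
  ... | no  _ = ≡.refl

  Iᴹ-diagonal : ∀ {n} (i : Fin n) → Iᴹ i i ≈ 1#
  Iᴹ-diagonal zero    = refl
  Iᴹ-diagonal (suc i) = trans (reflexive (Iᴹ-suc i i)) (Iᴹ-diagonal i)

  Iᴹ-upper : ∀ {n} → IsUpper (Iᴹ {n})
  Iᴹ-upper (suc k) zero    _       = refl
  Iᴹ-upper (suc k) (suc l) (s≤s p) = trans (reflexive (Iᴹ-suc k l)) (Iᴹ-upper k l p)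

  block : ∀ {n} → Carrier → Vector Carrier n → Matrix {n} → Matrix {suc n}
  block x r X zero    = x ∷ r
  block x r X (suc k) = 0# ∷ X k

  lowerBlock : ∀ {n} → Matrix {suc n} → Matrix {n}
  lowerBlock M k l = M (suc k) (suc l)

  block-cong : ∀ {n} {x y} {r s : Vector Carrier n} {X Y : Matrix} →
               x ≈ y → r ≋ s → X ≈ᴹ Y → block x r X ≈ᴹ block y s Y
  block-cong x≈y r≋s X≈Y zero    zero    = x≈y
  block-cong x≈y r≋s X≈Y zero    (suc l) = r≋s l
  block-cong x≈y r≋s X≈Y (suc k) zero    = refl
  block-cong x≈y r≋s X≈Y (suc k) (suc l) = X≈Y k l

  block-upper : ∀ {n} {x} {r : Vector Carrier n} {X : Matrix} → IsUpper X → IsUpper (block x r X)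
  block-upper X-upper (suc k) zero    _       = refl
  block-upper X-upper (suc k) (suc l) (s≤s p) = X-upper k l p

  upper⇒block : ∀ {n} {M : Matrix {suc n}} → IsUpper M →
                M ≈ᴹ block (M zero zero) (tail (M zero)) (lowerBlock M)
  upper⇒block M-upper zero    zero    = refl
  upper⇒block M-upper zero    (suc l) = refl
  upper⇒block M-upper (suc k) zero    = M-upper (suc k) zero (s≤s z≤n)
  upper⇒block M-upper (suc k) (suc l) = refl

  Iᴹ-block : ∀ {n} → Iᴹ {suc n} ≈ᴹ block 1# (λ _ → 0#) Iᴹ
  Iᴹ-block zero    zero    = refl
  Iᴹ-block zero    (suc l) = refl
  Iᴹ-block (suc k) zero    = refl
  Iᴹ-block (suc k) (suc l) = reflexive (Iᴹ-suc k l)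

  ᵛ*-block : ∀ {n} (r : Vector Carrier (suc n)) y (s : Vector Carrier n) (Y : Matrix) →
             r ᵛ* block y s Y ≋ (r zero * y) ∷ (λ l → r zero * s l + (tail r ᵛ* Y) l)
  ᵛ*-block r y s Y zero    = trans (+-congˡ (sum-*-zeroʳ (tail r))) (+-identityʳ _)
  ᵛ*-block r y s Y (suc l) = refl

  block-*ᴹ : ∀ {n} x (r : Vector Carrier n) X y s Y →
             (block x r X *ᴹ block y s Y) ≈ᴹ block (x * y) (λ l → x * s l + (r ᵛ* Y) l) (X *ᴹ Y)
  block-*ᴹ x r X y s Y zero            = ᵛ*-block (x ∷ r) y s Y
  block-*ᴹ x r X y s Y (suc k) zero    = trans (ᵛ*-block (0# ∷ X k) y s Y zero) (zeroˡ y)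
  block-*ᴹ x r X y s Y (suc k) (suc l) = trans (+-congʳ (zeroˡ (s l))) (+-identityˡ _)

  ᵛ*-identityʳ : ∀ {n} (r : Vector Carrier n) → r ᵛ* Iᴹ ≋ r
  ᵛ*-identityʳ {zero}  r ()
  ᵛ*-identityʳ {suc n} r = begin
    r ᵛ* Iᴹ                                                 ≈⟨ ᵛ*-congʳ r Iᴹ-block ⟩
    r ᵛ* block 1# (λ _ → 0#) Iᴹ                             ≈⟨ ᵛ*-block r 1# (λ _ → 0#) Iᴹ ⟩
    (r zero * 1#) ∷ (λ l → r zero * 0# + (tail r ᵛ* Iᴹ) l)  ≈⟨ simplify ⟩
    r                                                       ∎
    where
    open SetoidReasoning (≋-setoid (suc n))
    simplify : (r zero * 1#) ∷ (λ l → r zero * 0# + (tail r ᵛ* Iᴹ) l) ≋ r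
    simplify zero    = *-identityʳ (r zero)
    simplify (suc l) = trans (+-congʳ (zeroʳ (r zero)))
                             (trans (+-identityˡ _) (ᵛ*-identityʳ (tail r) l))

  x*[-y*z]+z≈0 : ∀ {x y} z → x * y ≈ 1# → x * (- y * z) + z ≈ 0#
  x*[-y*z]+z≈0 {x} {y} z xy≈1 = begin
    x * (- y * z) + z  ≈⟨ +-congʳ (sym (*-assoc x (- y) z)) ⟩
    x * - y * z + z    ≈⟨ +-congʳ (*-congʳ (sym (-‿distribʳ-* x y))) ⟩
    - (x * y) * z + z  ≈⟨ +-congʳ (*-congʳ (-‿cong xy≈1)) ⟩
    - 1# * z + z       ≈⟨ +-congʳ (-1*x≈-x z) ⟩
    - z + z            ≈⟨ -‿inverseˡ z ⟩
    0#                 ∎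
    where open SetoidReasoning setoid

  x*y+-x*y≈0 : ∀ x y → x * y + - x * y ≈ 0#
  x*y+-x*y≈0 x y = trans (+-congˡ (sym (-‿distribˡ-* x y))) (-‿inverseʳ (x * y))

  blockInverse : ∀ {n} → Carrier → Vector Carrier n → Matrix {n} → Matrix {suc n}
  blockInverse b r B′ = block b (λ l → - b * (r ᵛ* B′) l) B′

  blockInverse-inverseʳ : ∀ {n} {a b} {r : Vector Carrier n} {M′ B′ : Matrix} →
                          a * b ≈ 1# → (M′ *ᴹ B′) ≈ᴹ Iᴹ →
                          (block a r M′ *ᴹ blockInverse b r B′) ≈ᴹ Iᴹ
  blockInverse-inverseʳ {n} {a} {b} {r} {M′} {B′} ab≈1 M′B′≈I = begin
    block a r M′ *ᴹ blockInverse b r B′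
      ≈⟨ block-*ᴹ a r M′ b _ B′ ⟩
    block (a * b) (λ l → a * (- b * s l) + s l) (M′ *ᴹ B′)
      ≈⟨ block-cong ab≈1 (λ l → x*[-y*z]+z≈0 (s l) ab≈1) M′B′≈I ⟩
    block 1# (λ _ → 0#) Iᴹ
      ≈⟨ ≈ᴹ-sym Iᴹ-block ⟩
    Iᴹ ∎
    where
    s = r ᵛ* B′
    open SetoidReasoning (matrixSetoid (suc n))

  blockInverse-inverseˡ : ∀ {n} {a b} {r : Vector Carrier n} {M′ B′ : Matrix} →
                          a * b ≈ 1# → (B′ *ᴹ M′) ≈ᴹ Iᴹ →
                          (blockInverse b r B′ *ᴹ block a r M′) ≈ᴹ Iᴹ
  blockInverse-inverseˡ {n} {a} {b} {r} {M′} {B′} ab≈1 B′M′≈I = begin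
    blockInverse b r B′ *ᴹ block a r M′
      ≈⟨ block-*ᴹ b _ B′ a r M′ ⟩
    block (b * a) (λ l → b * r l + ((λ k → - b * s k) ᵛ* M′) l) (B′ *ᴹ M′)
      ≈⟨ block-cong (trans (*-comm b a) ab≈1) top-row≈0 B′M′≈I ⟩
    block 1# (λ _ → 0#) Iᴹ
      ≈⟨ ≈ᴹ-sym Iᴹ-block ⟩
    Iᴹ ∎
    where
    s = r ᵛ* B′
    s*M′≈r : s ᵛ* M′ ≋ r
    s*M′≈r = ≋-trans (ᵛ*-*ᴹ-assoc r B′ M′) (≋-trans (ᵛ*-congʳ r B′M′≈I) (ᵛ*-identityʳ r))
    top-row≈0 : (λ l → b * r l + ((λ k → - b * s k) ᵛ* M′) l) ≋ λ _ → 0#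
    top-row≈0 l = trans (+-congˡ (trans (ᵛ*-scalarˡ (- b) s M′ l) (*-congˡ (s*M′≈r l))))
                        (x*y+-x*y≈0 b (r l))
    open SetoidReasoning (matrixSetoid (suc n))

  invertible-diagonal⇒IsUnit : ∀ {n} (A : Tn {n}) → (∀ i → IsInvertible (proj₁ A i i)) → IsUnit A
  invertible-diagonal⇒IsUnit {zero}  _ _ = ((λ ()) , λ ()) , (λ ()) , λ ()
  invertible-diagonal⇒IsUnit {suc n} (M , M-upper) diagonal-invertible
    with diagonal-invertible zero
       | invertible-diagonal⇒IsUnit (lowerBlock M , λ k l l<k → M-upper (suc k) (suc l) (s≤s l<k))
                                    (diagonal-invertible ∘ suc)
  ... | b , ab≈1 | (B′ , B′-upper) , M′B′≈I , B′M′≈I =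
    (B , block-upper B′-upper) ,
    ≈ᴹ-trans (*ᴹ-congˡ B (upper⇒block M-upper)) (blockInverse-inverseʳ ab≈1 M′B′≈I) ,
    ≈ᴹ-trans (*ᴹ-congʳ B (upper⇒block M-upper)) (blockInverse-inverseˡ ab≈1 B′M′≈I)
    where B = blockInverse b (tail (M zero)) B′

  _+ᴹ_ : ∀ {n} → Matrix {n} → Matrix → Matrix
  (A +ᴹ B) i j = A i j + B i j

  diagonal : ∀ {n} → Vector Carrier n → Matrix {n}
  diagonal v i j = Iᴹ i j * v i

  diagonal-diagonal : ∀ {n} (v : Vector Carrier n) i → diagonal v i i ≈ v i
  diagonal-diagonal v i = trans (*-congʳ (Iᴹ-diagonal i)) (*-identityˡ (v i))

  diagonal-upper : ∀ {n} (v : Vector Carrier n) → IsUpper (diagonal v)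
  diagonal-upper v i j j<i = trans (*-congʳ (Iᴹ-upper i j j<i)) (zeroˡ (v i))

  +ᴹ-upper : ∀ {n} {A B : Matrix {n}} → IsUpper A → IsUpper B → IsUpper (A +ᴹ B)
  +ᴹ-upper A-upper B-upper i j j<i =
    trans (+-cong (A-upper i j j<i) (B-upper i j j<i)) (+-identityʳ 0#)

  -ᴹ-upper : ∀ {n} {A B : Matrix {n}} → IsUpper A → IsUpper B → IsUpper (A -ᴹ B)
  -ᴹ-upper A-upper B-upper i j j<i =
    trans (+-cong (A-upper i j j<i) (-‿cong (B-upper i j j<i))) (-‿inverseʳ 0#)

module UnitaryCayleyGraph {c ℓ : Level} (R : CommutativeRing c ℓ) where
  open CommutativeRing R hiding (zero)
  open import Algebra.Properties.AbelianGroup +-abelianGroup using (⁻¹-∙-comm; xyx⁻¹≈y)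
  open UpperTriangularMatrices R

  IsSumOfTwoUnits : Carrier → Set (c ⊔ ℓ)
  IsSumOfTwoUnits x = ∃ λ v → IsInvertible v × IsInvertible (x - v)

  isInvertible-resp-≈ : ∀ {x y} → x ≈ y → IsInvertible x → IsInvertible y
  isInvertible-resp-≈ x≈y (z , xz≈1) = z , trans (*-congʳ (sym x≈y)) xz≈1

  x-[y+z]≈x-y-z : ∀ x y z → x - (y + z) ≈ x - y - z
  x-[y+z]≈x-y-z x y z = trans (+-congˡ (sym (⁻¹-∙-comm y z))) (sym (+-assoc x (- y) (- z)))

  module _ (1≉0 : 1# ≉ 0#) where

    invertible-diagonal⇒Adj : ∀ {m} (A B : Tn {suc m}) →
                              (∀ i → IsInvertible (proj₁ A i i - proj₁ B i i)) → Adj A B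
    invertible-diagonal⇒Adj (A , A-upper) (B , B-upper) diagonal-invertible =
      A≉B , invertible-diagonal⇒IsUnit (A -ᴹ B , -ᴹ-upper A-upper B-upper) diagonal-invertible
      where
      A≉B : ¬ (A ≈ᴹ B)
      A≉B A≈B with diagonal-invertible zero
      ... | y , [a-b]y≈1 = 1≉0 (begin
        1#                               ≈⟨ sym [a-b]y≈1 ⟩
        (A zero zero - B zero zero) * y  ≈⟨ *-congʳ (trans (+-congʳ (A≈B zero zero)) (-‿inverseʳ _)) ⟩
        0# * y                           ≈⟨ zeroˡ y ⟩
        0#                               ∎)
        where open SetoidReasoning setoid

    Tn-connected : (∀ x → IsSumOfTwoUnits x) → ∀ {m} → Connected {suc m}
    Tn-connected split (A , A-upper) (B , B-upper) =
      _◅_ {j = C} (invertible-diagonal⇒Adj (A , A-upper) C A-C-invertible)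
                  (invertible-diagonal⇒Adj C (B , B-upper) C-B-invertible ◅ ε)
      where
      v : Vector Carrier _
      v i = proj₁ (split (A i i - B i i))
      C : Tn
      C = B +ᴹ diagonal v , +ᴹ-upper B-upper (diagonal-upper v)
      A-C-invertible : ∀ i → IsInvertible (A i i - proj₁ C i i)
      A-C-invertible i = isInvertible-resp-≈
        (sym (trans (+-congˡ (-‿cong (+-congˡ (diagonal-diagonal v i)))) (x-[y+z]≈x-y-z _ _ _)))
        (proj₂ (proj₂ (split (A i i - B i i))))
      C-B-invertible : ∀ i → IsInvertible (proj₁ C i i - B i i)
      C-B-invertible i = isInvertible-resp-≈
        (sym (trans (+-congʳ (+-congˡ (diagonal-diagonal v i))) (xyx⁻¹≈y (B i i) (v i))))
        (proj₁ (proj₂ (split (A i i - B i i))))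

module _ {a ℓ : Level} (S : DecSetoid a ℓ) where
  open DecSetoid S
  open import Relation.Binary.Properties.Setoid setoid using (≉-sym; ≉-respˡ; ≉-respʳ)

  avoid-pair₂ : ∀ {x y a} → x ≉ y → x ≉ a → y ≉ a → ∀ b → ∃ λ v → v ≉ a × v ≉ b
  avoid-pair₂ {x} {y} x≉y x≉a y≉a b with x ≟ b
  ... | no  x≉b = x , x≉a , x≉b
  ... | yes x≈b = y , y≉a , ≉-sym (≉-respˡ x≈b x≉y)

  avoid-pair₃ : ∀ {x y z} → x ≉ y → x ≉ z → y ≉ z → ∀ a b → ∃ λ v → v ≉ a × v ≉ b
  avoid-pair₃ {z = z} x≉y x≉z y≉z a b with z ≟ a | z ≟ b
  ... | no z≉a | no  z≉b = z , z≉a , z≉b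
  ... | yes z≈a | _      = avoid-pair₂ x≉y (≉-respʳ z≈a x≉z) (≉-respʳ z≈a y≉z) b
  ... | no _   | yes z≈b = map₂ swap (avoid-pair₂ x≉y (≉-respʳ z≈b x≉z) (≉-respʳ z≈b y≉z) a)

module FiniteRing {c ℓ : Level} (F : CommutativeRing c ℓ) where
  open CommutativeRing F hiding (zero)
  open HasCardinality

  ≈-decidable : ∀ {q} → HasCardinality F q → Decidable _≈_
  ≈-decidable card x y with surjective card x | surjective card y
  ... | i , i↦x | j , j↦y =
    map′ (λ i≡j → trans (sym i↦x) (trans (reflexive (≡.cong (enum card) i≡j)) j↦y))
         (λ x≈y → injective card i j (trans i↦x (trans x≈y (sym j↦y))))
         (i Fin.≟ j)

  finiteDecSetoid : ∀ {q} → HasCardinality F q → DecSetoid c ℓ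
  finiteDecSetoid card = record
    { isDecEquivalence = record { isEquivalence = isEquivalence ; _≟_ = ≈-decidable card } }

  three-distinct : ∀ {q} → HasCardinality F q → 1# ≉ 0# → q ≢ 2 →
                   ∃ λ x → ∃ λ y → ∃ λ z → x ≉ y × x ≉ z × y ≉ z
  three-distinct {0} card _ _ with surjective card 0#
  ... | () , _
  three-distinct {1} card 1≉0 _ with surjective card 1# | surjective card 0#
  ... | zero , 1↦1 | zero , 0↦0 = ⊥-elim (1≉0 (trans (sym 1↦1) 0↦0))
  three-distinct {2} _ _ q≢2 = ⊥-elim (q≢2 ≡.refl)
  three-distinct {suc (suc (suc _))} card _ _ =
    enum card zero , enum card (suc zero) , enum card (suc (suc zero)) ,
    enum-≉ (λ ()) , enum-≉ (λ ()) , enum-≉ (λ ())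
    where
    enum-≉ : ∀ {i j} → i ≢ j → enum card i ≉ enum card j
    enum-≉ i≢j e = i≢j (injective card _ _ e)

module FiniteField {c ℓ : Level} (F : CommutativeRing c ℓ) (isField : IsField F) where
  open CommutativeRing F hiding (zero)
  open IsField isField
  open import Algebra.Properties.AbelianGroup +-abelianGroup using (x∙y⁻¹≈ε⇒x≈y)
  open UnitaryCayleyGraph F using (IsSumOfTwoUnits)
  open FiniteRing F

  isSumOfTwoUnits : ∀ {q} → HasCardinality F q → q ≢ 2 → ∀ d → IsSumOfTwoUnits d
  isSumOfTwoUnits card q≢2 d with three-distinct card 1≉0 q≢2
  ... | _ , _ , _ , x≉y , x≉z , y≉z with avoid-pair₃ (finiteDecSetoid card) x≉y x≉z y≉z 0# d
  ... | v , v≉0 , v≉d =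
    v , inverse v v≉0 , inverse (d - v) (λ d-v≈0 → v≉d (sym (x∙y⁻¹≈ε⇒x≈y d v d-v≈0)))

theorem3 : {c ℓ : Level} (F : CommutativeRing c ℓ) → IsField F →
    (q : ℕ) → HasCardinality F q → ¬ (q ≡ 2) →
    (n : ℕ) → n ≥ 2 → UpperTriangular.Connected F n
theorem3 F isField q card q≢2 (suc m) (s≤s _) =
  Tn-connected (IsField.1≉0 isField) (isSumOfTwoUnits card q≢2)
  where
  open UnitaryCayleyGraph F
  open FiniteField F isField
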